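{- Let $G$ be a finite connected simple graph with vertex set $V$, twin classes $C_1,\dots,C_k$, induced subgraphs $G_i=G[C_i]$ (each of which is complete or edgeless), representatives $c_i\in C_i$ and reduced graph $H=G[\{c_1,\dots,c_k\}]$. Let $m\ge 2$ and let $S\subseteq V$ with $|S|=m$. Put $I(S)=\{i: S\cap C_i\ne\emptyset\}$, $l=|I(S)|$, $S_r=\{c_i: i\in I(S)\}$ and $t_i=|S\cap C_i|$. Then $$d_G^m(S)=\begin{cases} m-1 & \text{if } I(S)=\{i\} \text{ and } G_i \text{ is complete},\\ m & \text{if } I(S)=\{i\} \text{ and } G_i \text{ is edgeless},\\ d_H^l(S_r)+\sum_{i\in I(S)}(t_i-1) & \text{if } l>1.\end{cases}$$
   Context: $N_G(v)$ denotes the open neighbourhood of $v$. The twin relation $u\sim^G v$ iff $N_G(u)\setminus\{v\}=N_G(v)\setminus\{u\}$ is an equivalence relation on $V(G)$; its classes are the twin classes. For a connected graph $X$ and a set $S$ of $l$ vertices, the $l$-Steiner distance $d_X^l(S)$ is the number of edges of a smallest subtree of $X$ containing $S$. -}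

module Defs where

open import Data.Nat using (ℕ; zero; suc; _+_; _∸_; _≤_; _<ᵇ_)
open import Data.Bool using (Bool; true; false; _∧_; _∨_; if_then_else_)
open import Data.Fin using (Fin; zero; suc; toℕ; _≟_)
open import Data.Fin.Subset using (Subset; _∈_; _⊆_; ∣_∣; _∩_)
open import Data.Vec using (tabulate; lookup)
open import Data.List using (List; []; _∷_; length; _∷ʳ_)
open import Data.List.Relation.Unary.Unique.Propositional using (Unique)
open import Data.List.Relation.Unary.Linked using (Linked)
open import Data.Product using (Σ; _×_; _,_)
open import Relation.Binary.PropositionalEquality using (_≡_; _≢_)
open import Relation.Nullary using (¬_)
open import Relation.Nullary.Decidable using (⌊_⌋)
open import Function.Bundles using (_⇔_)

record Graph (n : ℕ) : Set where
  field
    adj    : Fin n → Fin n → Bool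
    sym    : ∀ u v → adj u v ≡ adj v u
    irrefl : ∀ v → adj v v ≡ false
open Graph public

data Walk {n : ℕ} (R : Fin n → Fin n → Bool) : Fin n → Fin n → Set where
  []  : ∀ {u} → Walk R u u
  _∷_ : ∀ {u v w} → R u v ≡ true → Walk R v w → Walk R u w

Connected : ∀ {n} → Graph n → Set
Connected G = ∀ u v → Walk (adj G) u v

∑ : ∀ {k} → (Fin k → ℕ) → ℕ
∑ {zero}  f = 0
∑ {suc k} f = f zero + ∑ (λ i → f (suc i))

anyFin : ∀ {k} → (Fin k → Bool) → Bool
anyFin {zero}  f = false
anyFin {suc k} f = f zero ∨ anyFin (λ i → f (suc i))

edgeCount : ∀ {n} → (Fin n → Fin n → Bool) → ℕ
edgeCount E = ∑ λ i → ∑ λ j → if (toℕ i <ᵇ toℕ j) ∧ E i j then 1 else 0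

record Subtree {n : ℕ} (X : Graph n) : Set where
  field
    W         : Subset n
    E         : Fin n → Fin n → Bool
    E-sym     : ∀ u v → E u v ≡ E v u
    E-sub     : ∀ u v → E u v ≡ true → (adj X u v ≡ true) × (u ∈ W) × (v ∈ W)
    connected : ∀ u v → u ∈ W → v ∈ W → Walk E u v
    acyclic   : ∀ u vs → 2 ≤ length vs → Unique (u ∷ vs) →
                ¬ Linked (λ a b → E a b ≡ true) ((u ∷ vs) ∷ʳ u)
open Subtree public

numEdges : ∀ {n} {X : Graph n} → Subtree X → ℕ
numEdges T = edgeCount (E T)

IsSteinerDist : ∀ {n} → Graph n → Subset n → ℕ → Set
IsSteinerDist X S d =
  (Σ (Subtree X) λ T → (S ⊆ W T) × (numEdges T ≡ d)) ×
  (∀ (T : Subtree X) → S ⊆ W T → d ≤ numEdges T)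

Twin : ∀ {n} → Graph n → Fin n → Fin n → Set
Twin G u v = ∀ w → ((adj G u w ≡ true) × (w ≢ v)) ⇔ ((adj G v w ≡ true) × (w ≢ u))

induced : ∀ {n k} → Graph n → (Fin k → Fin n) → Graph k
induced G rep = record
  { adj    = λ i j → adj G (rep i) (rep j)
  ; sym    = λ i j → sym G (rep i) (rep j)
  ; irrefl = λ i → irrefl G (rep i) }

classOf : ∀ {n k} → (Fin n → Fin k) → Fin k → Subset n
classOf cls i = tabulate λ v → ⌊ cls v ≟ i ⌋

indexSet : ∀ {n k} → (Fin n → Fin k) → Subset n → Subset k
indexSet cls S = tabulate λ i → anyFin λ v → lookup S v ∧ ⌊ cls v ≟ i ⌋

IsComplete : ∀ {n} → Graph n → Subset n → Set
IsComplete G C = ∀ u v → u ∈ C → v ∈ C → u ≢ v → adj G u v ≡ true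

IsEdgeless : ∀ {n} → Graph n → Subset n → Set
IsEdgeless G C = ∀ u v → u ∈ C → v ∈ C → adj G u v ≡ false

-- A subtree of X containing S has one edge fewer than vertices, and its vertices form a
-- connected set containing S; conversely a connected set U ⊇ S carries a spanning subtree
-- with ∣U∣ − 1 edges. So the Steiner distance of S is one less than the least size of a
-- connected superset of S, a cover. If S lies in one twin class, the least cover is S itself
-- when the class is complete, and S plus one common neighbour when it is edgeless. Otherwise,
-- adjacency between distinct twin classes depends only on the classes, so a cover W of S
-- projects to a cover π W of I(S) in H, and counting class by class (at least t_i vertices in
-- each class meeting S, at least one in every other class met by W) gives
-- ∣W∣ ≥ ∣S∣ + ∣π W∣ − ∣I(S)∣. Conversely a cover U of I(S) in H lifts to S plus one
-- representative of each class of U ∖ I(S). The least cover sizes therefore differ by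
-- ∣S∣ − ∣I(S)∣ = Σ_{i ∈ I(S)} (t_i − 1).

module Submission where

open import Defs renaming (sym to adj-sym)
open import Data.Nat using (ℕ; zero; suc; _+_; _∸_; _≤_; _<_; _≤?_; z≤n; s≤s; _<ᵇ_)
open import Data.Nat.Properties
  using (+-identityʳ; +-comm; +-suc; +-mono-≤; +-monoʳ-≤; ≤-refl; ≤-trans; ≤-antisym;
         ≤-reflexive; <⇒≱; m≤n+m; ≮⇒≥; m≤n⇒m<n∨m≡n; ∸-monoˡ-≤; +-∸-assoc; m∸n+n≡m;
         +-cancelʳ-≤; +-0-commutativeMonoid; +-commutativeSemigroup; module ≤-Reasoning)
open import Data.Bool using (Bool; true; false; _∧_; _∨_; if_then_else_)
import Data.Bool as Bool
open import Data.Bool.Properties using (∨-zeroʳ; ∧-zeroʳ; ∧-comm; ∨-comm; ¬-not)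
open import Data.Fin using (Fin; zero; suc; toℕ; _≟_)
open import Data.Fin.Properties using (toℕ-injective; any?; all?)
open import Data.Fin.Subset
  using (Subset; _∈_; _∉_; _⊆_; ∣_∣; _∩_; _∪_; ⁅_⁆; ⊤; inside; outside)
open import Data.Fin.Subset.Properties
  using (_∈?_; _⊆?_; anySubset?; x∈⁅x⁆; x∈⁅y⁆⇒x≡y; ∣⁅x⁆∣≡1; ∣⊥∣≡0; ∈⊤; Empty-unique;
         p⊆q⇒∣p∣≤∣q∣; p⊂q⇒∣p∣<∣q∣; ∣p∣≤n; ⊆-antisym; x∈p∪q⁺; x∈p∪q⁻; x∈p∩q⁺; x∈p∩q⁻;
         ∪-identityʳ)
open import Data.Vec using ([]; _∷_; tabulate; lookup; here; there)
open import Data.Vec.Properties using (lookup∘tabulate; []=⇒lookup; lookup⇒[]=; lookup-zipWith)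
open import Data.Product using (Σ; _×_; _,_; proj₁; proj₂)
open import Data.Sum using (_⊎_; inj₁; inj₂)
open import Data.Empty using (⊥; ⊥-elim)
open import Relation.Binary.PropositionalEquality
  using (_≡_; _≢_; refl; sym; trans; cong; cong₂; subst; subst₂; module ≡-Reasoning)
open import Relation.Nullary using (¬_; Dec; yes; no)
open import Relation.Nullary.Decidable
  using (⌊_⌋; _×-dec_; _→-dec_; ¬?; map′; decidable-stable)
import Algebra.Properties.CommutativeMonoid.Sum as MonoidSum
open import Algebra.Properties.CommutativeSemigroup +-commutativeSemigroup using (xy∙z≈xz∙y)
open import Function.Bundles using (Equivalence)
open import Function.Construct.Symmetry using (⇔-sym)
open import Data.List using ([]; _∷_; _++_; _∷ʳ_; length)
open import Data.List.Properties using (++-assoc)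
open import Data.List.Membership.Propositional using () renaming (_∈_ to _∈ₗ_)
open import Data.List.Membership.Propositional.Properties using (∈-∃++; ∈-++⁺ˡ; ∈-++⁺ʳ)
open import Data.List.Relation.Unary.Any using (here; there)
import Data.List.Relation.Unary.Any as Any
open import Data.List.Relation.Unary.All using (All; []; _∷_)
import Data.List.Relation.Unary.All as All
open import Data.List.Relation.Unary.All.Properties using (¬Any⇒All¬; ∷ʳ⁺)
open import Data.List.Relation.Unary.AllPairs using ([]; _∷_)
open import Data.List.Relation.Unary.Unique.Propositional using (Unique)
open import Data.List.Relation.Unary.Linked using (Linked; []; [-]; _∷_)

𝟙 : Bool → ℕ
𝟙 b = if b then 1 else 0

∧≡true⁻ : ∀ {a b} → a ∧ b ≡ true → a ≡ true × b ≡ true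
∧≡true⁻ {true} {true} _ = refl , refl

∨≡true⁻ : ∀ {a b} → a ∨ b ≡ true → a ≡ true ⊎ b ≡ true
∨≡true⁻ {true} _ = inj₁ refl
∨≡true⁻ {false} e = inj₂ e

≟-true⁻ : ∀ {n} {x y : Fin n} → ⌊ x ≟ y ⌋ ≡ true → x ≡ y
≟-true⁻ {x = x} {y} e with x ≟ y
... | yes x≡y = x≡y

≟-refl : ∀ {n} (x : Fin n) → ⌊ x ≟ x ⌋ ≡ true
≟-refl x with x ≟ x
... | yes _ = refl
... | no x≢x = ⊥-elim (x≢x refl)

true≢false : true ≢ false
true≢false ()

∈⇒lookup : ∀ {n} {x : Fin n} {p : Subset n} → x ∈ p → lookup p x ≡ true
∈⇒lookup = []=⇒lookup

lookup⇒∈ : ∀ {n} {x : Fin n} {p : Subset n} → lookup p x ≡ true → x ∈ p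
lookup⇒∈ {x = x} {p} = lookup⇒[]= x p

𝟙-∈ : ∀ {n} {x : Fin n} {p : Subset n} → x ∈ p → 𝟙 (lookup p x) ≡ 1
𝟙-∈ x∈p = cong 𝟙 (∈⇒lookup x∈p)

𝟙-∉ : ∀ {n} {x : Fin n} {p : Subset n} → x ∉ p → 𝟙 (lookup p x) ≡ 0
𝟙-∉ x∉p = cong 𝟙 (¬-not (λ e → x∉p (lookup⇒∈ e)))

subsetOf : ∀ {n} {P : Fin n → Set} → (∀ x → Dec (P x)) → Subset n
subsetOf P? = tabulate (λ x → ⌊ P? x ⌋)

module _ {n} {P : Fin n → Set} (P? : ∀ x → Dec (P x)) where

  ∈-subsetOf⁺ : ∀ {x} → P x → x ∈ subsetOf P?
  ∈-subsetOf⁺ {x} px = lookup⇒∈ (trans (lookup∘tabulate (λ y → ⌊ P? y ⌋) x) (holds (P? x)))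
    where
    holds : (d : Dec (P x)) → ⌊ d ⌋ ≡ true
    holds (yes _) = refl
    holds (no ¬px) = ⊥-elim (¬px px)

  ∈-subsetOf⁻ : ∀ {x} → x ∈ subsetOf P? → P x
  ∈-subsetOf⁻ {x} x∈ = holds (P? x) (trans (sym (lookup∘tabulate (λ y → ⌊ P? y ⌋) x)) (∈⇒lookup x∈))
    where
    holds : (d : Dec (P x)) → ⌊ d ⌋ ≡ true → P x
    holds (yes px) _ = px

anyFin⁺ : ∀ {k} (f : Fin k → Bool) x → f x ≡ true → anyFin f ≡ true
anyFin⁺ f zero fx rewrite fx = refl
anyFin⁺ f (suc x) fx = trans (cong (f zero ∨_) (anyFin⁺ (λ i → f (suc i)) x fx)) (∨-zeroʳ _)

anyFin⁻ : ∀ {k} (f : Fin k → Bool) → anyFin f ≡ true → Σ (Fin k) λ x → f x ≡ true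
anyFin⁻ {suc _} f e with ∨≡true⁻ {f zero} e
... | inj₁ f0 = zero , f0
... | inj₂ rest = let (x , fx) = anyFin⁻ (λ i → f (suc i)) rest in suc x , fx

-- Finite sums and cardinalities

∑-cong : ∀ {k} {f g : Fin k → ℕ} → (∀ i → f i ≡ g i) → ∑ f ≡ ∑ g
∑-cong {zero} _ = refl
∑-cong {suc _} f≗g = cong₂ _+_ (f≗g zero) (∑-cong (λ i → f≗g (suc i)))

∑-mono : ∀ {k} {f g : Fin k → ℕ} → (∀ i → f i ≤ g i) → ∑ f ≤ ∑ g
∑-mono {zero} _ = z≤n
∑-mono {suc _} f≤g = +-mono-≤ (f≤g zero) (∑-mono (λ i → f≤g (suc i)))

∑-zero : ∀ {k} {f : Fin k → ℕ} → (∀ i → f i ≡ 0) → ∑ f ≡ 0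
∑-zero {zero} _ = refl
∑-zero {suc _} f≗0 rewrite f≗0 zero = ∑-zero (λ i → f≗0 (suc i))

module ℕSum = MonoidSum +-0-commutativeMonoid

∑≡sum : ∀ {k} (f : Fin k → ℕ) → ∑ f ≡ ℕSum.sum f
∑≡sum {zero} f = refl
∑≡sum {suc _} f = cong (f zero +_) (∑≡sum (λ i → f (suc i)))

∑-distrib-+ : ∀ {k} (f g : Fin k → ℕ) → ∑ (λ i → f i + g i) ≡ ∑ f + ∑ g
∑-distrib-+ f g = begin
  ∑ (λ i → f i + g i)           ≡⟨ ∑≡sum (λ i → f i + g i) ⟩
  ℕSum.sum (λ i → f i + g i)    ≡⟨ ℕSum.∑-distrib-+ f g ⟩
  ℕSum.sum f + ℕSum.sum g       ≡⟨ sym (cong₂ _+_ (∑≡sum f) (∑≡sum g)) ⟩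
  ∑ f + ∑ g                     ∎
  where open ≡-Reasoning

∑-comm : ∀ {k l} (f : Fin k → Fin l → ℕ) → ∑ (λ i → ∑ (λ j → f i j)) ≡ ∑ (λ j → ∑ (λ i → f i j))
∑-comm f = begin
  ∑ (λ i → ∑ (λ j → f i j))               ≡⟨ ∑-cong (λ i → ∑≡sum (f i)) ⟩
  ∑ (λ i → ℕSum.sum (f i))                ≡⟨ ∑≡sum (λ i → ℕSum.sum (f i)) ⟩
  ℕSum.sum (λ i → ℕSum.sum (f i))         ≡⟨ ℕSum.∑-comm f ⟩
  ℕSum.sum (λ j → ℕSum.sum (λ i → f i j)) ≡⟨ sym (∑≡sum (λ j → ℕSum.sum (λ i → f i j))) ⟩
  ∑ (λ j → ℕSum.sum (λ i → f i j))        ≡⟨ sym (∑-cong (λ j → ∑≡sum (λ i → f i j))) ⟩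
  ∑ (λ j → ∑ (λ i → f i j))               ∎
  where open ≡-Reasoning

∑-if-≟ : ∀ {k} (v : Fin k) (g : Fin k → ℕ) → ∑ (λ i → if ⌊ v ≟ i ⌋ then g i else 0) ≡ g v
∑-if-≟ {suc k} zero g = trans (cong (g zero +_) (∑-zero {k} (λ _ → refl))) (+-identityʳ _)
∑-if-≟ {suc _} (suc v) g = trans (∑-cong step) (∑-if-≟ v (λ i → g (suc i)))
  where
  step : ∀ i → (if ⌊ suc v ≟ suc i ⌋ then g (suc i) else 0) ≡ (if ⌊ v ≟ i ⌋ then g (suc i) else 0)
  step i with v ≟ i
  ... | yes _ = refl
  ... | no _ = refl

∣p∣≡∑ : ∀ {n} (p : Subset n) → ∣ p ∣ ≡ ∑ (λ x → 𝟙 (lookup p x))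
∣p∣≡∑ [] = refl
∣p∣≡∑ (true ∷ p) = cong suc (∣p∣≡∑ p)
∣p∣≡∑ (false ∷ p) = ∣p∣≡∑ p

∣p∪⁅x⁆∣≡1+∣p∣ : ∀ {n} {x : Fin n} (p : Subset n) → x ∉ p → ∣ p ∪ ⁅ x ⁆ ∣ ≡ suc ∣ p ∣
∣p∪⁅x⁆∣≡1+∣p∣ {x = zero} (outside ∷ p) _ = cong suc (cong ∣_∣ (∪-identityʳ p))
∣p∪⁅x⁆∣≡1+∣p∣ {x = zero} (inside ∷ p) x∉p = ⊥-elim (x∉p here)
∣p∪⁅x⁆∣≡1+∣p∣ {x = suc x} (outside ∷ p) x∉p = ∣p∪⁅x⁆∣≡1+∣p∣ p (λ x∈p → x∉p (there x∈p))
∣p∪⁅x⁆∣≡1+∣p∣ {x = suc x} (inside ∷ p) x∉p = cong suc (∣p∪⁅x⁆∣≡1+∣p∣ p (λ x∈p → x∉p (there x∈p)))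

x∈p⇒1≤∣p∣ : ∀ {n} {x : Fin n} {p : Subset n} → x ∈ p → 1 ≤ ∣ p ∣
x∈p⇒1≤∣p∣ {x = x} {p} x∈p = subst (_≤ ∣ p ∣) (∣⁅x⁆∣≡1 x) (p⊆q⇒∣p∣≤∣q∣ ⁅x⁆⊆p)
  where
  ⁅x⁆⊆p : ⁅ x ⁆ ⊆ p
  ⁅x⁆⊆p y∈⁅x⁆ = subst (_∈ p) (sym (x∈⁅y⁆⇒x≡y x y∈⁅x⁆)) x∈p

∣p∣≡0 : ∀ {n} {p : Subset n} → (∀ {x} → x ∉ p) → ∣ p ∣ ≡ 0
∣p∣≡0 {n} empty = trans (cong ∣_∣ (Empty-unique (λ (_ , x∈p) → empty x∈p))) (∣⊥∣≡0 n)

two-elements : ∀ {n} (p : Subset n) → 1 < ∣ p ∣ →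
               Σ (Fin n) λ a → Σ (Fin n) λ b → a ∈ p × b ∈ p × a ≢ b
two-elements p 1<∣p∣ with any? (_∈? p)
... | no none = ⊥-elim (<⇒≱ 1<∣p∣ (subst (_≤ 1) (sym (∣p∣≡0 (λ {x} x∈p → none (x , x∈p)))) z≤n))
... | yes (a , a∈p) with any? (λ b → (b ∈? p) ×-dec ¬? (b ≟ a))
...   | yes (b , b∈p , b≢a) = a , b , a∈p , b∈p , λ a≡b → b≢a (sym a≡b)
...   | no none = ⊥-elim (<⇒≱ 1<∣p∣ (subst (∣ p ∣ ≤_) (∣⁅x⁆∣≡1 a) (p⊆q⇒∣p∣≤∣q∣ p⊆⁅a⁆)))
  where
  p⊆⁅a⁆ : p ⊆ ⁅ a ⁆
  p⊆⁅a⁆ {y} y∈p with y ≟ a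
  ... | yes refl = x∈⁅x⁆ a
  ... | no y≢a = ⊥-elim (none (y , y∈p , y≢a))

-- Counting edges

𝟙-∧ : ∀ b c → 𝟙 (b ∧ c) ≡ (if c then 𝟙 b else 0)
𝟙-∧ b true = cong 𝟙 (∧-comm b true)
𝟙-∧ b false = cong 𝟙 (∧-zeroʳ b)

𝟙-<ᵇ-total : ∀ {m n} → m ≢ n → 𝟙 (m <ᵇ n) + 𝟙 (n <ᵇ m) ≡ 1
𝟙-<ᵇ-total {zero} {zero} m≢n = ⊥-elim (m≢n refl)
𝟙-<ᵇ-total {zero} {suc _} _ = refl
𝟙-<ᵇ-total {suc _} {zero} _ = refl
𝟙-<ᵇ-total {suc m} {suc n} m≢n = 𝟙-<ᵇ-total (λ m≡n → m≢n (cong suc m≡n))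

edgeCount-mono : ∀ {n} {E F : Fin n → Fin n → Bool} →
                 (∀ i j → E i j ≡ true → F i j ≡ true) → edgeCount E ≤ edgeCount F
edgeCount-mono E⇒F = ∑-mono (λ i → ∑-mono (λ j → 𝟙-mono (toℕ i <ᵇ toℕ j) (E⇒F i j)))
  where
  𝟙-mono : ∀ c {a b} → (a ≡ true → b ≡ true) → 𝟙 (c ∧ a) ≤ 𝟙 (c ∧ b)
  𝟙-mono false _ = z≤n
  𝟙-mono true {false} _ = z≤n
  𝟙-mono true {true} a⇒b rewrite a⇒b refl = ≤-refl

edgeCount-∨ : ∀ {n} {E F : Fin n → Fin n → Bool} → (∀ i j → E i j ≡ true → F i j ≡ false) →
              edgeCount (λ i j → E i j ∨ F i j) ≡ edgeCount E + edgeCount F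
edgeCount-∨ {E = E} {F} disjoint = begin
  ∑ (λ i → ∑ (λ j → 𝟙 (i<j i j ∧ (E i j ∨ F i j))))
    ≡⟨ ∑-cong (λ i → ∑-cong (λ j → 𝟙-∧∨ (i<j i j) (disjoint i j))) ⟩
  ∑ (λ i → ∑ (λ j → 𝟙 (i<j i j ∧ E i j) + 𝟙 (i<j i j ∧ F i j)))
    ≡⟨ ∑-cong (λ i → ∑-distrib-+ (λ j → 𝟙 (i<j i j ∧ E i j)) (λ j → 𝟙 (i<j i j ∧ F i j))) ⟩
  ∑ (λ i → ∑ (λ j → 𝟙 (i<j i j ∧ E i j)) + ∑ (λ j → 𝟙 (i<j i j ∧ F i j)))
    ≡⟨ ∑-distrib-+ (λ i → ∑ (λ j → 𝟙 (i<j i j ∧ E i j))) (λ i → ∑ (λ j → 𝟙 (i<j i j ∧ F i j))) ⟩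
  edgeCount E + edgeCount F ∎
  where
  open ≡-Reasoning
  i<j : _ → _ → Bool
  i<j i j = toℕ i <ᵇ toℕ j
  𝟙-∧∨ : ∀ c {e f} → (e ≡ true → f ≡ false) → 𝟙 (c ∧ (e ∨ f)) ≡ 𝟙 (c ∧ e) + 𝟙 (c ∧ f)
  𝟙-∧∨ false _ = refl
  𝟙-∧∨ true {true} e⇒¬f rewrite e⇒¬f refl = refl
  𝟙-∧∨ true {false} _ = refl

edgeCount-empty : ∀ {n} → edgeCount {n} (λ _ _ → false) ≡ 0
edgeCount-empty {n} = ∑-zero {n} (λ i → ∑-zero {n} (λ j → cong 𝟙 (∧-zeroʳ (toℕ i <ᵇ toℕ j))))

arc : ∀ {n} → Fin n → Fin n → Fin n → Fin n → Bool
arc v a x y = ⌊ v ≟ x ⌋ ∧ ⌊ a ≟ y ⌋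

link : ∀ {n} → Fin n → Fin n → Fin n → Fin n → Bool
link v a x y = arc v a x y ∨ arc a v x y

arc⁻ : ∀ {n} (v a x y : Fin n) → arc v a x y ≡ true → x ≡ v × y ≡ a
arc⁻ v a x y e = let (v≟x , a≟y) = ∧≡true⁻ {⌊ v ≟ x ⌋} e in sym (≟-true⁻ v≟x) , sym (≟-true⁻ a≟y)

link-sym : ∀ {n} (v a x y : Fin n) → link v a x y ≡ link v a y x
link-sym v a x y =
  trans (cong₂ _∨_ (∧-comm ⌊ v ≟ x ⌋ ⌊ a ≟ y ⌋) (∧-comm ⌊ a ≟ x ⌋ ⌊ v ≟ y ⌋))
        (∨-comm (arc a v y x) (arc v a y x))

link⁻ : ∀ {n} (v a x y : Fin n) → link v a x y ≡ true → (x ≡ v × y ≡ a) ⊎ (x ≡ a × y ≡ v)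
link⁻ v a x y e with ∨≡true⁻ {arc v a x y} e
... | inj₁ e′ = inj₁ (arc⁻ v a x y e′)
... | inj₂ e′ = inj₂ (arc⁻ a v x y e′)

link-here : ∀ {n} (v a : Fin n) → link v a v a ≡ true
link-here v a rewrite ≟-refl v | ≟-refl a = refl

edgeCount-arc : ∀ {n} (v a : Fin n) → edgeCount (arc v a) ≡ 𝟙 (toℕ v <ᵇ toℕ a)
edgeCount-arc {n} v a = trans (∑-cong row) (∑-if-≟ v (λ _ → 𝟙 (toℕ v <ᵇ toℕ a)))
  where
  row : ∀ i → ∑ (λ j → 𝟙 ((toℕ i <ᵇ toℕ j) ∧ (⌊ v ≟ i ⌋ ∧ ⌊ a ≟ j ⌋))) ≡
              (if ⌊ v ≟ i ⌋ then 𝟙 (toℕ v <ᵇ toℕ a) else 0)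
  row i with v ≟ i
  ... | yes refl = trans (∑-cong (λ j → 𝟙-∧ (toℕ i <ᵇ toℕ j) ⌊ a ≟ j ⌋))
                         (∑-if-≟ a (λ j → 𝟙 (toℕ i <ᵇ toℕ j)))
  ... | no _ = ∑-zero {n} (λ j → cong 𝟙 (∧-zeroʳ (toℕ i <ᵇ toℕ j)))

edgeCount-link : ∀ {n} {v a : Fin n} → v ≢ a → edgeCount (link v a) ≡ 1
edgeCount-link {v = v} {a} v≢a = begin
  edgeCount (link v a)                        ≡⟨ edgeCount-∨ disjoint ⟩
  edgeCount (arc v a) + edgeCount (arc a v)   ≡⟨ cong₂ _+_ (edgeCount-arc v a) (edgeCount-arc a v) ⟩
  𝟙 (toℕ v <ᵇ toℕ a) + 𝟙 (toℕ a <ᵇ toℕ v)     ≡⟨ 𝟙-<ᵇ-total (λ e → v≢a (toℕ-injective e)) ⟩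
  1                                           ∎
  where
  open ≡-Reasoning
  disjoint : ∀ i j → arc v a i j ≡ true → arc a v i j ≡ false
  disjoint i j e = ¬-not (λ e′ → v≢a (trans (sym (proj₁ (arc⁻ v a i j e))) (proj₁ (arc⁻ a v i j e′))))

-- Walks and connected vertex sets

infixr 5 _++ʷ_
_++ʷ_ : ∀ {n} {R : Fin n → Fin n → Bool} {u v w} → Walk R u v → Walk R v w → Walk R u w
[] ++ʷ q = q
(e ∷ p) ++ʷ q = e ∷ (p ++ʷ q)

mapʷ : ∀ {n} {R R′ : Fin n → Fin n → Bool} → (∀ a b → R a b ≡ true → R′ a b ≡ true) →
       ∀ {u v} → Walk R u v → Walk R′ u v
mapʷ f [] = []
mapʷ f (e ∷ p) = f _ _ e ∷ mapʷ f p

-- Only the target of a step is tested, so a walk from a vertex of U along Within A U stays in U.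
Within : ∀ {n} → (Fin n → Fin n → Bool) → Subset n → Fin n → Fin n → Bool
Within A U a b = A a b ∧ lookup U b

module _ {n} {A : Fin n → Fin n → Bool} {U : Subset n} where

  within⁺ : ∀ {a b} → A a b ≡ true → b ∈ U → Within A U a b ≡ true
  within⁺ ab b∈U = cong₂ _∧_ ab (∈⇒lookup b∈U)

  within⁻ : ∀ {a b} → Within A U a b ≡ true → A a b ≡ true × b ∈ U
  within⁻ {a} {b} e = let (ab , Ub) = ∧≡true⁻ {A a b} e in ab , lookup⇒∈ Ub

  first-step : ∀ {a b} → Walk (Within A U) a b → a ≢ b → Σ (Fin n) λ z → z ∈ U × A a z ≡ true
  first-step [] a≢b = ⊥-elim (a≢b refl)
  first-step (e ∷ _) _ = _ , proj₂ (within⁻ e) , proj₁ (within⁻ e)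

  last-step : ∀ {a b} → Walk (Within A U) a b → a ∈ U → a ≢ b → Σ (Fin n) λ y → y ∈ U × A y b ≡ true
  last-step [] _ a≢b = ⊥-elim (a≢b refl)
  last-step {a} {b} (_∷_ {v = z} e w) a∈U _ with z ≟ b
  ... | yes refl = a , a∈U , proj₁ (within⁻ e)
  ... | no z≢b = last-step w (proj₂ (within⁻ e)) z≢b

  leaving-edge : ∀ {V : Subset n} {y x} → Walk (Within A U) y x → y ∈ V → x ∉ V →
                 Σ (Fin n) λ p → Σ (Fin n) λ q → p ∈ V × q ∈ U × q ∉ V × A p q ≡ true
  leaving-edge [] y∈V x∉V = ⊥-elim (x∉V y∈V)
  leaving-edge {V} {y} (_∷_ {v = z} e w) y∈V x∉V with z ∈? V
  ... | yes z∈V = leaving-edge w z∈V x∉V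
  ... | no z∉V = y , z , y∈V , proj₂ (within⁻ e) , z∉V , proj₁ (within⁻ e)

Within-mono : ∀ {n} {A B : Fin n → Fin n → Bool} {U : Subset n} → (∀ a b → A a b ≡ true → B a b ≡ true) →
              ∀ a b → Within A U a b ≡ true → Within B U a b ≡ true
Within-mono {A = A} {B} {U} A⇒B a b e =
  let (ab , b∈U) = within⁻ {A = A} {U} e in within⁺ {A = B} (A⇒B a b ab) b∈U

WalkConnected : ∀ {n} → Graph n → Fin n → Subset n → Set
WalkConnected X r U = ∀ v → v ∈ U → Walk (Within (adj X) U) r v

neighbour : ∀ {n} {X : Graph n} {r U} → WalkConnected X r U → r ∈ U → ∀ {x} → x ∈ U → x ≢ r →
            ∀ {j} → j ∈ U → Σ (Fin n) λ y → y ∈ U × adj X y j ≡ true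
neighbour {X = X} {r} walks r∈U x∈U x≢r {j} j∈U with j ≟ r
... | yes refl = let (z , z∈U , jz) = first-step (walks _ x∈U) (λ j≡x → x≢r (sym j≡x))
                 in z , z∈U , trans (adj-sym X z j) jz
... | no j≢r = last-step (walks j j∈U) r∈U (λ r≡j → j≢r (sym r≡j))

Crossing : ∀ {n} → Graph n → Subset n → Subset n → Set
Crossing {n} X U V = Σ (Fin n) λ p → Σ (Fin n) λ q → p ∈ V × q ∈ U × q ∉ V × adj X p q ≡ true

-- Unlike WalkConnected, this is decidable by enumerating subsets, and spanning subtrees are
-- grown along its crossing edges.
CutConnected : ∀ {n} → Graph n → Fin n → Subset n → Set
CutConnected X r U = ∀ V → r ∈ V → V ⊆ U → ∀ x → x ∈ U → x ∉ V → Crossing X U V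

walk⇒cut : ∀ {n} {X : Graph n} {r U} → WalkConnected X r U → CutConnected X r U
walk⇒cut walks V r∈V _ x x∈U x∉V = leaving-edge (walks x x∈U) r∈V x∉V

all-subsets? : ∀ {n} {P : Subset n → Set} → (∀ V → Dec (P V)) → Dec (∀ V → P V)
all-subsets? P? with anySubset? (λ V → ¬? (P? V))
... | yes (V , ¬PV) = no (λ all → ¬PV (all V))
... | no none = yes (λ V → decidable-stable (P? V) (λ ¬PV → none (V , ¬PV)))

crossing? : ∀ {n} (X : Graph n) U V → Dec (Crossing X U V)
crossing? X U V =
  any? (λ p → any? (λ q → (p ∈? V) ×-dec (q ∈? U) ×-dec ¬? (q ∈? V) ×-dec (adj X p q Bool.≟ true)))

cutConnected? : ∀ {n} (X : Graph n) r U → Dec (CutConnected X r U)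
cutConnected? X r U = all-subsets? (λ V → (r ∈? V) →-dec (V ⊆? U) →-dec
                        all? (λ x → (x ∈? U) →-dec ¬? (x ∈? V) →-dec crossing? X U V))

-- Subtrees

module _ {A : Set} {R : A → A → Set} where

  Linked-drop : ∀ xs {ys} → Linked R (xs ++ ys) → Linked R ys
  Linked-drop [] l = l
  Linked-drop (x ∷ []) {[]} _ = []
  Linked-drop (x ∷ []) {y ∷ ys} (_ ∷ l) = l
  Linked-drop (x ∷ x′ ∷ xs) (_ ∷ l) = Linked-drop (x′ ∷ xs) l

  Linked-pred : ∀ x xs y ys → Linked R (x ∷ xs ++ y ∷ ys) →
                Σ A λ z → R z y × ((z ≡ x × xs ≡ []) ⊎ z ∈ₗ xs)
  Linked-pred x [] y ys (r ∷ _) = x , r , inj₁ (refl , refl)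
  Linked-pred x (x′ ∷ xs) y ys (_ ∷ l) with Linked-pred x′ xs y ys l
  ... | z , r , inj₁ (refl , _) = z , r , inj₂ (here refl)
  ... | z , r , inj₂ z∈xs = z , r , inj₂ (there z∈xs)

  Linked-restrict : ∀ {P : A → Set} {S : A → A → Set} → (∀ {x y} → P x → P y → R x y → S x y) →
                    ∀ {xs} → All P xs → Linked R xs → Linked S xs
  Linked-restrict f [] [] = []
  Linked-restrict f (_ ∷ []) [-] = [-]
  Linked-restrict f (px ∷ py ∷ ps) (r ∷ l) = f px py r ∷ Linked-restrict f (py ∷ ps) l

  Unique-++⇒distinct : ∀ xs {ys} {a b : A} → Unique (xs ++ ys) → a ∈ₗ xs → b ∈ₗ ys → a ≢ b
  Unique-++⇒distinct (x ∷ xs) (x∉ ∷ _) (here refl) b∈ys = All.lookup x∉ (∈-++⁺ʳ xs b∈ys)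
  Unique-++⇒distinct (x ∷ xs) (_ ∷ uq) (there a∈xs) b∈ys = Unique-++⇒distinct xs uq a∈xs b∈ys

  cycle-neighbours : ∀ u vs {x} → 2 ≤ length vs → Unique (u ∷ vs) → Linked R ((u ∷ vs) ∷ʳ u) →
                     x ∈ₗ u ∷ vs → Σ A λ p → Σ A λ q → R p x × R x q × p ≢ q
  cycle-neighbours u (w ∷ []) (s≤s ()) _ _ (here refl)
  cycle-neighbours u (w ∷ w′ ∷ ws) _ (_ ∷ (w∉ ∷ _)) (uw ∷ l) (here refl)
    with Linked-pred w (w′ ∷ ws) u [] l
  ... | p , pu , inj₂ p∈ = p , w , pu , uw , λ p≡w → All.lookup w∉ p∈ (sym p≡w)
  cycle-neighbours u vs {x} len (u∉ ∷ uq) l (there x∈vs) with ∈-∃++ x∈vs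
  ... | pre , post , refl =
    around pre post len u∉ uq (subst (Linked R) (cong (u ∷_) (++-assoc pre (x ∷ post) (u ∷ []))) l)
    where
    around : ∀ pre post → 2 ≤ length (pre ++ x ∷ post) → All (u ≢_) (pre ++ x ∷ post) →
             Unique (pre ++ x ∷ post) → Linked R (u ∷ pre ++ x ∷ post ++ u ∷ []) →
             Σ A λ p → Σ A λ q → R p x × R x q × p ≢ q
    around pre post len u∉ uq l with Linked-pred u pre x (post ++ u ∷ []) l | Linked-drop (u ∷ pre) l
    around [] [] (s≤s ()) _ _ _ | _ | _
    around [] (s ∷ post) _ u∉ _ _ | p , px , inj₁ (refl , _) | xs ∷ _ =
      p , s , px , xs , All.lookup u∉ (there (here refl))
    around (y ∷ pre) [] _ u∉ _ _ | p , px , inj₂ p∈ | xu ∷ _ =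
      p , u , px , xu , λ p≡u → All.lookup u∉ (∈-++⁺ˡ p∈) (sym p≡u)
    around (y ∷ pre) (s ∷ post) _ _ uq _ | p , px , inj₂ p∈ | xs ∷ _ =
      p , s , px , xs , Unique-++⇒distinct (y ∷ pre) uq p∈ (there (here refl))

subtree-walk : ∀ {n} {X : Graph n} (T : Subtree X) {u v} → u ∈ W T → v ∈ W T →
               Walk (Within (E T) (W T)) u v
subtree-walk T u∈W v∈W =
  mapʷ (λ a b e → within⁺ {A = E T} e (proj₂ (proj₂ (E-sub T a b e)))) (connected T _ _ u∈W v∈W)

subtree-walkᴳ : ∀ {n} {X : Graph n} (T : Subtree X) {u v} → u ∈ W T → v ∈ W T →
                Walk (Within (adj X) (W T)) u v
subtree-walkᴳ {X = X} T u∈W v∈W =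
  mapʷ (Within-mono {A = E T} {adj X} {W T} (λ a b e → proj₁ (E-sub T a b e))) (subtree-walk T u∈W v∈W)

singleton : ∀ {n} {X : Graph n} → Fin n → Subtree X
singleton r = record
  { W = ⁅ r ⁆ ; E = λ _ _ → false ; E-sym = λ _ _ → refl ; E-sub = λ _ _ ()
  ; connected = walk ; acyclic = no-cycle }
  where
  walk : ∀ u v → u ∈ ⁅ r ⁆ → v ∈ ⁅ r ⁆ → Walk (λ _ _ → false) u v
  walk u v u∈ v∈ rewrite x∈⁅y⁆⇒x≡y r u∈ | x∈⁅y⁆⇒x≡y r v∈ = []
  no-cycle : ∀ u vs → 2 ≤ length vs → Unique (u ∷ vs) → ¬ Linked (λ _ _ → false ≡ true) ((u ∷ vs) ∷ʳ u)
  no-cycle u [] _ _ (() ∷ _)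
  no-cycle u (_ ∷ _) _ _ (() ∷ _)

module _ {n} {X : Graph n} (T : Subtree X) {v a : Fin n}
         (v∉W : v ∉ W T) (a∈W : a ∈ W T) (va : adj X v a ≡ true) where

  private
    E′ : Fin n → Fin n → Bool
    E′ x y = E T x y ∨ link v a x y

    v≢a : v ≢ a
    v≢a refl = v∉W a∈W

    no-E-out-of-v : ∀ y → E T v y ≡ false
    no-E-out-of-v y = ¬-not (λ e → v∉W (proj₁ (proj₂ (E-sub T v y e))))

    E′-out-of-v : ∀ y → E′ v y ≡ true → y ≡ a
    E′-out-of-v y e rewrite no-E-out-of-v y with link⁻ v a v y e
    ... | inj₁ (_ , y≡a) = y≡a
    ... | inj₂ (v≡a , _) = ⊥-elim (v≢a v≡a)

    E′-into-v : ∀ x → E′ x v ≡ true → x ≡ a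
    E′-into-v x e = E′-out-of-v x (trans (cong₂ _∨_ (E-sym T v x) (link-sym v a v x)) e)

    E′⇒E : ∀ {x y} → v ≢ x → v ≢ y → E′ x y ≡ true → E T x y ≡ true
    E′⇒E {x} {y} v≢x v≢y e with ∨≡true⁻ {E T x y} e
    ... | inj₁ e′ = e′
    ... | inj₂ e′ with link⁻ v a x y e′
    ...   | inj₁ (x≡v , _) = ⊥-elim (v≢x (sym x≡v))
    ...   | inj₂ (_ , y≡v) = ⊥-elim (v≢y (sym y≡v))

    E⇒E′ : ∀ x y → E T x y ≡ true → E′ x y ≡ true
    E⇒E′ x y e rewrite e = refl

    W′ : Subset n
    W′ = W T ∪ ⁅ v ⁆

    W⊆W′ : W T ⊆ W′
    W⊆W′ x∈W = x∈p∪q⁺ (inj₁ x∈W)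

    v∈W′ : v ∈ W′
    v∈W′ = x∈p∪q⁺ (inj₂ (x∈⁅x⁆ v))

    E′-sub : ∀ x y → E′ x y ≡ true → (adj X x y ≡ true) × (x ∈ W′) × (y ∈ W′)
    E′-sub x y e with ∨≡true⁻ {E T x y} e
    ... | inj₁ e′ = let (xy , x∈W , y∈W) = E-sub T x y e′ in xy , W⊆W′ x∈W , W⊆W′ y∈W
    ... | inj₂ e′ with link⁻ v a x y e′
    ...   | inj₁ (refl , refl) = va , v∈W′ , W⊆W′ a∈W
    ...   | inj₂ (refl , refl) = trans (adj-sym X a v) va , W⊆W′ a∈W , v∈W′

    E′-va : E′ v a ≡ true
    E′-va = trans (cong (E T v a ∨_) (link-here v a)) (∨-zeroʳ _)

    E′-av : E′ a v ≡ true
    E′-av = trans (cong₂ _∨_ (E-sym T a v) (link-sym v a a v)) E′-va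

    E′-walk : ∀ x y → x ∈ W′ → y ∈ W′ → Walk E′ x y
    E′-walk x y x∈ y∈ with x∈p∪q⁻ (W T) ⁅ v ⁆ x∈ | x∈p∪q⁻ (W T) ⁅ v ⁆ y∈
    ... | inj₁ x∈W | inj₁ y∈W = mapʷ E⇒E′ (connected T x y x∈W y∈W)
    ... | inj₁ x∈W | inj₂ y∈⁅v⁆ rewrite x∈⁅y⁆⇒x≡y v y∈⁅v⁆ =
      mapʷ E⇒E′ (connected T x a x∈W a∈W) ++ʷ (E′-av ∷ [])
    ... | inj₂ x∈⁅v⁆ | inj₁ y∈W rewrite x∈⁅y⁆⇒x≡y v x∈⁅v⁆ =
      E′-va ∷ mapʷ E⇒E′ (connected T a y a∈W y∈W)
    ... | inj₂ x∈⁅v⁆ | inj₂ y∈⁅v⁆ rewrite x∈⁅y⁆⇒x≡y v x∈⁅v⁆ | x∈⁅y⁆⇒x≡y v y∈⁅v⁆ = []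

    -- A cycle through the new leaf v would need two distinct neighbours of v, but v has only a.
    E′-acyclic : ∀ u vs → 2 ≤ length vs → Unique (u ∷ vs) →
                 ¬ Linked (λ x y → E′ x y ≡ true) ((u ∷ vs) ∷ʳ u)
    E′-acyclic u vs len uq cycle with Any.any? (v ≟_) (u ∷ vs)
    ... | yes v∈ =
      let (p , q , pv , vq , p≢q) = cycle-neighbours u vs len uq cycle v∈
      in p≢q (trans (E′-into-v p pv) (sym (E′-out-of-v q vq)))
    ... | no v∉ = acyclic T u vs len uq (Linked-restrict E′⇒E avoids-v cycle)
      where
      avoids-v : All (v ≢_) ((u ∷ vs) ∷ʳ u)
      avoids-v = let v≢ = ¬Any⇒All¬ (u ∷ vs) v∉ in ∷ʳ⁺ v≢ (All.head v≢)

  addLeaf : Subtree X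
  addLeaf = record
    { W = W′ ; E = E′ ; E-sym = λ x y → cong₂ _∨_ (E-sym T x y) (link-sym v a x y)
    ; E-sub = E′-sub ; connected = E′-walk ; acyclic = E′-acyclic }

  numEdges-addLeaf : numEdges addLeaf ≡ suc (numEdges T)
  numEdges-addLeaf = begin
    edgeCount (λ x y → E T x y ∨ link v a x y)   ≡⟨ edgeCount-∨ E-avoids-link ⟩
    numEdges T + edgeCount (link v a)            ≡⟨ cong (numEdges T +_) (edgeCount-link v≢a) ⟩
    numEdges T + 1                               ≡⟨ +-comm (numEdges T) 1 ⟩
    suc (numEdges T)                             ∎
    where
    open ≡-Reasoning
    E-avoids-link : ∀ x y → E T x y ≡ true → link v a x y ≡ false
    E-avoids-link x y e = ¬-not λ l → case (link⁻ v a x y l)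
      where
      case : (x ≡ v × y ≡ a) ⊎ (x ≡ a × y ≡ v) → ⊥
      case (inj₁ (refl , _)) = v∉W (proj₁ (proj₂ (E-sub T x y e)))
      case (inj₂ (_ , refl)) = v∉W (proj₂ (proj₂ (E-sub T x y e)))

module _ {n} (X : Graph n) {r : Fin n} {U : Subset n} (r∈U : r ∈ U) (cut : CutConnected X r U) where

  private
    Partial : Subtree X → Set
    Partial T = W T ⊆ U × r ∈ W T × suc (numEdges T) ≡ ∣ W T ∣

    grow : ∀ fuel T → Partial T → ∣ U ∣ ≤ ∣ W T ∣ + fuel →
           Σ (Subtree X) λ T′ → W T′ ≡ U × suc (numEdges T′) ≡ ∣ U ∣
    grow fuel T (W⊆U , r∈W , size) bound with any? (λ x → (x ∈? U) ×-dec ¬? (x ∈? W T))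
    ... | no none = T , W≡U , trans size (cong ∣_∣ W≡U)
      where
      W≡U : W T ≡ U
      W≡U = ⊆-antisym W⊆U (λ {x} x∈U → decidable-stable (x ∈? W T) (λ x∉W → none (x , x∈U , x∉W)))
    grow zero T (W⊆U , _ , _) bound | yes (x , x∈U , x∉W) =
      ⊥-elim (<⇒≱ (p⊂q⇒∣p∣<∣q∣ (W⊆U , x , x∈U , x∉W)) (subst (∣ U ∣ ≤_) (+-identityʳ _) bound))
    grow (suc fuel) T (W⊆U , r∈W , size) bound | yes (x , x∈U , x∉W)
      with cut (W T) r∈W W⊆U x x∈U x∉W
    ... | p , q , p∈W , q∈U , q∉W , pq = grow fuel T′ (W′⊆U , x∈p∪q⁺ (inj₁ r∈W) , size′) bound′
      where
      qp : adj X q p ≡ true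
      qp = trans (adj-sym X q p) pq
      T′ : Subtree X
      T′ = addLeaf T q∉W p∈W qp
      ∣W′∣ : ∣ W T′ ∣ ≡ suc ∣ W T ∣
      ∣W′∣ = ∣p∪⁅x⁆∣≡1+∣p∣ (W T) q∉W
      W′⊆U : W T′ ⊆ U
      W′⊆U y∈W′ with x∈p∪q⁻ (W T) ⁅ q ⁆ y∈W′
      ... | inj₁ y∈W = W⊆U y∈W
      ... | inj₂ y∈⁅q⁆ = subst (_∈ U) (sym (x∈⁅y⁆⇒x≡y q y∈⁅q⁆)) q∈U
      size′ : suc (numEdges T′) ≡ ∣ W T′ ∣
      size′ = trans (cong suc (numEdges-addLeaf T q∉W p∈W qp)) (trans (cong suc size) (sym ∣W′∣))
      bound′ : ∣ U ∣ ≤ ∣ W T′ ∣ + fuel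
      bound′ = subst (λ s → ∣ U ∣ ≤ s + fuel) (sym ∣W′∣) (subst (∣ U ∣ ≤_) (+-suc _ fuel) bound)

  spanning-subtree : Σ (Subtree X) λ T → W T ≡ U × suc (numEdges T) ≡ ∣ U ∣
  spanning-subtree = grow n (singleton r) (⁅r⁆⊆U , x∈⁅x⁆ r , size) (≤-trans (∣p∣≤n U) (m≤n+m n _))
    where
    ⁅r⁆⊆U : ⁅ r ⁆ ⊆ U
    ⁅r⁆⊆U x∈⁅r⁆ = subst (_∈ U) (sym (x∈⁅y⁆⇒x≡y r x∈⁅r⁆)) r∈U
    size : suc (numEdges (singleton {X = X} r)) ≡ ∣ ⁅ r ⁆ ∣
    size = trans (cong suc (edgeCount-empty {n})) (sym (∣⁅x⁆∣≡1 r))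

cut⇒walk : ∀ {n} {X : Graph n} {r U} → r ∈ U → CutConnected X r U → WalkConnected X r U
cut⇒walk {X = X} r∈U cut v v∈U with spanning-subtree X r∈U cut
... | T , refl , _ = subtree-walkᴳ T r∈U v∈U

∣W∣≤1+numEdges : ∀ {n} {X : Graph n} (T : Subtree X) {r} → r ∈ W T → ∣ W T ∣ ≤ suc (numEdges T)
∣W∣≤1+numEdges {n} {X} T r∈W
  with spanning-subtree treeGraph r∈W (walk⇒cut {X = treeGraph} (λ v → subtree-walk T r∈W))
  where
  treeGraph : Graph n
  treeGraph = record
    { adj = E T ; sym = E-sym T
    ; irrefl = λ v → ¬-not (λ e → true≢false (trans (sym (proj₁ (E-sub T v v e))) (irrefl X v))) }
... | T′ , _ , size =
  subst (_≤ suc (numEdges T)) size (s≤s (edgeCount-mono {E = E T′} {E T} (λ i j e → proj₁ (E-sub T′ i j e))))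

-- Connected covers and Steiner distance

ConnectedCover : ∀ {n} → Graph n → Fin n → Subset n → Subset n → Set
ConnectedCover X r S U = S ⊆ U × WalkConnected X r U

connectedCover? : ∀ {n} {X : Graph n} {r S} → r ∈ S → ∀ U → Dec (ConnectedCover X r S U)
connectedCover? {X = X} {r} {S} r∈S U =
  map′ from-cut to-cut ((S ⊆? U) ×-dec cutConnected? X r U)
  where
  from-cut : S ⊆ U × CutConnected X r U → ConnectedCover X r S U
  from-cut (S⊆U , cut) = S⊆U , cut⇒walk {X = X} (S⊆U r∈S) cut
  to-cut : ConnectedCover X r S U → S ⊆ U × CutConnected X r U
  to-cut (S⊆U , walks) = S⊆U , walk⇒cut {X = X} walks

⊤-cover : ∀ {n} {X : Graph n} {r S} → Connected X → ConnectedCover X r S ⊤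
⊤-cover {X = X} {r} connectedX =
  (λ _ → ∈⊤) , λ v _ → mapʷ (λ a b e → within⁺ {A = adj X} e ∈⊤) (connectedX r v)

subtree-cover : ∀ {n} {X : Graph n} (T : Subtree X) {r S} → S ⊆ W T → r ∈ S → ConnectedCover X r S (W T)
subtree-cover T S⊆W r∈S = S⊆W , λ v v∈W → subtree-walkᴳ T (S⊆W r∈S) v∈W

-- The witness is only required to have size ≤ c; minimality then forces equality.
IsMinCoverSize : ∀ {n} → Graph n → Fin n → Subset n → ℕ → Set
IsMinCoverSize {n} X r S c = (Σ (Subset n) λ U → ConnectedCover X r S U × ∣ U ∣ ≤ c) ×
                             (∀ U → ConnectedCover X r S U → c ≤ ∣ U ∣)

minCoverSize-positive : ∀ {n} {X : Graph n} {r S c} → r ∈ S → IsMinCoverSize X r S c → 1 ≤ c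
minCoverSize-positive r∈S ((U , (S⊆U , _) , ∣U∣≤c) , _) = ≤-trans (x∈p⇒1≤∣p∣ (S⊆U r∈S)) ∣U∣≤c

least : ∀ {P : ℕ → Set} → (∀ c → Dec (P c)) → ∀ {b} → P b → Σ ℕ λ c → P c × (∀ {c′} → P c′ → c ≤ c′)
least {P} P? {b} pb = search 0 b (λ ()) pb
  where
  search : ∀ k b → (∀ {c} → c < k → ¬ P c) → P (k + b) → Σ ℕ λ c → P c × (∀ {c′} → P c′ → c ≤ c′)
  search k b below p with P? k
  ... | yes pk = k , pk , λ pc′ → ≮⇒≥ (λ c′<k → below c′<k pc′)
  ... | no ¬pk with b
  ...   | zero = ⊥-elim (¬pk (subst P (+-identityʳ k) p))
  ...   | suc b′ = search (suc k) b′ below′ (subst P (+-suc k b′) p)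
    where
    below′ : ∀ {c} → c < suc k → ¬ P c
    below′ (s≤s c≤k) with m≤n⇒m<n∨m≡n c≤k
    ... | inj₁ c<k = below c<k
    ... | inj₂ refl = ¬pk

minCoverSize-exists : ∀ {n} {X : Graph n} {r S U} → r ∈ S → ConnectedCover X r S U →
                      Σ ℕ (IsMinCoverSize X r S)
minCoverSize-exists {X = X} {U = U} r∈S cover
  with least (λ c → anySubset? (λ U → connectedCover? {X = X} r∈S U ×-dec (∣ U ∣ ≤? c))) (U , cover , ≤-refl)
... | c , small , minimal = c , small , λ U′ cover′ → minimal (U′ , cover′ , ≤-refl)

minCoverSize⇒steinerDist : ∀ {n} {X : Graph n} {r S c} → r ∈ S → IsMinCoverSize X r S c →
                           IsSteinerDist X S (c ∸ 1)
minCoverSize⇒steinerDist {X = X} {S = S} {c} r∈S ((U , (S⊆U , walks) , ∣U∣≤c) , minimal)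
  with spanning-subtree X (S⊆U r∈S) (walk⇒cut {X = X} walks)
... | T , refl , size = (T , S⊆U , edges) , lower
  where
  edges : numEdges T ≡ c ∸ 1
  edges = cong (_∸ 1) (trans size (≤-antisym ∣U∣≤c (minimal (W T) (S⊆U , walks))))
  lower : ∀ T′ → S ⊆ W T′ → c ∸ 1 ≤ numEdges T′
  lower T′ S⊆W′ = ∸-monoˡ-≤ 1 (≤-trans (minimal (W T′) (subtree-cover T′ S⊆W′ r∈S))
                                        (∣W∣≤1+numEdges T′ (S⊆W′ r∈S)))

-- Twin classes

module _ {n k} (cls : Fin n → Fin k) where

  ∈classOf⁺ : ∀ {x j} → cls x ≡ j → x ∈ classOf cls j
  ∈classOf⁺ {j = j} = ∈-subsetOf⁺ (λ v → cls v ≟ j)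

  ∈classOf⁻ : ∀ {x j} → x ∈ classOf cls j → cls x ≡ j
  ∈classOf⁻ {j = j} = ∈-subsetOf⁻ (λ v → cls v ≟ j)

  ∈indexSet⁺ : ∀ {W x} → x ∈ W → cls x ∈ indexSet cls W
  ∈indexSet⁺ {W} {x} x∈W = lookup⇒∈ (trans (lookup∘tabulate _ (cls x))
    (anyFin⁺ (λ v → lookup W v ∧ ⌊ cls v ≟ cls x ⌋) x (cong₂ _∧_ (∈⇒lookup x∈W) (≟-refl (cls x)))))

  ∈indexSet⁻ : ∀ W {j} → j ∈ indexSet cls W → Σ (Fin n) λ x → x ∈ W × cls x ≡ j
  ∈indexSet⁻ W {j} j∈ with anyFin⁻ (λ v → lookup W v ∧ ⌊ cls v ≟ j ⌋)
                               (trans (sym (lookup∘tabulate _ j)) (∈⇒lookup j∈))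
  ... | x , e = let (Wx , cx≟j) = ∧≡true⁻ {lookup W x} e in x , lookup⇒∈ Wx , ≟-true⁻ cx≟j

  ∣∩class∣≡0 : ∀ W {j} → j ∉ indexSet cls W → ∣ W ∩ classOf cls j ∣ ≡ 0
  ∣∩class∣≡0 W {j} j∉ = ∣p∣≡0 λ {x} x∈ →
    let (x∈W , x∈C) = x∈p∩q⁻ W (classOf cls j) x∈
    in j∉ (subst (_∈ indexSet cls W) (∈classOf⁻ x∈C) (∈indexSet⁺ x∈W))

  𝟙-indexSet≤ : ∀ W j → 𝟙 (lookup (indexSet cls W) j) ≤ ∣ W ∩ classOf cls j ∣
  𝟙-indexSet≤ W j with j ∈? indexSet cls W
  ... | yes j∈ = let (x , x∈W , cx≡j) = ∈indexSet⁻ W j∈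
                 in subst (_≤ ∣ W ∩ classOf cls j ∣) (sym (𝟙-∈ j∈))
                          (x∈p⇒1≤∣p∣ (x∈p∩q⁺ (x∈W , ∈classOf⁺ cx≡j)))
  ... | no j∉ = subst (_≤ ∣ W ∩ classOf cls j ∣) (sym (𝟙-∉ j∉)) z≤n

  ∣W∣≡∑classes : ∀ W → ∣ W ∣ ≡ ∑ (λ j → ∣ W ∩ classOf cls j ∣)
  ∣W∣≡∑classes W = begin
    ∣ W ∣                      ≡⟨ ∣p∣≡∑ W ⟩
    ∑ (λ x → 𝟙 (lookup W x))   ≡⟨ ∑-cong (λ x → sym (one-class x)) ⟩
    ∑ (λ x → ∑ (λ j → w x j))  ≡⟨ ∑-comm w ⟩
    ∑ (λ j → ∑ (λ x → w x j))  ≡⟨ ∑-cong (λ j → sym (∣∩class∣≡∑ j)) ⟩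
    ∑ (λ j → ∣ W ∩ classOf cls j ∣) ∎
    where
    open ≡-Reasoning
    w : Fin n → Fin k → ℕ
    w x j = 𝟙 (lookup W x ∧ ⌊ cls x ≟ j ⌋)
    one-class : ∀ x → ∑ (λ j → w x j) ≡ 𝟙 (lookup W x)
    one-class x = trans (∑-cong (λ j → 𝟙-∧ (lookup W x) ⌊ cls x ≟ j ⌋))
                        (∑-if-≟ (cls x) (λ _ → 𝟙 (lookup W x)))
    ∣∩class∣≡∑ : ∀ j → ∣ W ∩ classOf cls j ∣ ≡ ∑ (λ x → w x j)
    ∣∩class∣≡∑ j = trans (∣p∣≡∑ (W ∩ classOf cls j)) (∑-cong λ x → cong 𝟙
      (trans (lookup-zipWith _∧_ x W (classOf cls j)) (cong (lookup W x ∧_) (lookup∘tabulate _ x))))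

  classwise-≤ : ∀ (A B : Subset n) (P Q : Subset k) →
                (∀ j → ∣ A ∩ classOf cls j ∣ + 𝟙 (lookup P j) ≤ ∣ B ∩ classOf cls j ∣ + 𝟙 (lookup Q j)) →
                ∣ A ∣ + ∣ P ∣ ≤ ∣ B ∣ + ∣ Q ∣
  classwise-≤ A B P Q ≤ᶜ = begin
    ∣ A ∣ + ∣ P ∣                 ≡⟨ cong₂ _+_ (∣W∣≡∑classes A) (∣p∣≡∑ P) ⟩
    ∑ a + ∑ p                     ≡⟨ sym (∑-distrib-+ a p) ⟩
    ∑ (λ j → a j + p j)           ≤⟨ ∑-mono ≤ᶜ ⟩
    ∑ (λ j → b j + q j)           ≡⟨ ∑-distrib-+ b q ⟩
    ∑ b + ∑ q                     ≡⟨ sym (cong₂ _+_ (∣W∣≡∑classes B) (∣p∣≡∑ Q)) ⟩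
    ∣ B ∣ + ∣ Q ∣                 ∎
    where
    open ≤-Reasoning
    a b : Fin k → ℕ
    a j = ∣ A ∩ classOf cls j ∣
    b j = ∣ B ∩ classOf cls j ∣
    p q : Fin k → ℕ
    p j = 𝟙 (lookup P j)
    q j = 𝟙 (lookup Q j)

  -- Class by class: W holds the part of S in each class meeting S, and a vertex of every class it meets.
  ∣S∣+∣πW∣≤∣W∣+∣πS∣ : ∀ {S W} → S ⊆ W → ∣ S ∣ + ∣ indexSet cls W ∣ ≤ ∣ W ∣ + ∣ indexSet cls S ∣
  ∣S∣+∣πW∣≤∣W∣+∣πS∣ {S} {W} S⊆W = classwise-≤ S W (indexSet cls W) (indexSet cls S) per-class
    where
    per-class : ∀ j → ∣ S ∩ classOf cls j ∣ + 𝟙 (lookup (indexSet cls W) j) ≤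
                      ∣ W ∩ classOf cls j ∣ + 𝟙 (lookup (indexSet cls S) j)
    per-class j with j ∈? indexSet cls S
    ... | yes j∈πS = subst (∣ S ∩ classOf cls j ∣ + 𝟙 (lookup (indexSet cls W) j) ≤_)
                       (cong (∣ W ∩ classOf cls j ∣ +_) (sym (𝟙-∈ j∈πS)))
                       (+-mono-≤ (p⊆q⇒∣p∣≤∣q∣ S∩C⊆W∩C) (𝟙≤1 (lookup (indexSet cls W) j)))
      where
      S∩C⊆W∩C : S ∩ classOf cls j ⊆ W ∩ classOf cls j
      S∩C⊆W∩C x∈ = let (x∈S , x∈C) = x∈p∩q⁻ S _ x∈ in x∈p∩q⁺ (S⊆W x∈S , x∈C)
      𝟙≤1 : ∀ b → 𝟙 b ≤ 1
      𝟙≤1 true = ≤-refl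
      𝟙≤1 false = z≤n
    ... | no j∉πS = subst₂ _≤_ (cong (_+ 𝟙 (lookup (indexSet cls W) j)) (sym (∣∩class∣≡0 S j∉πS)))
                               (trans (sym (+-identityʳ _))
                                      (cong (∣ W ∩ classOf cls j ∣ +_) (sym (𝟙-∉ j∉πS))))
                               (𝟙-indexSet≤ W j)

  excess : Subset n → ℕ
  excess S = ∑ λ j → if lookup (indexSet cls S) j then ∣ S ∩ classOf cls j ∣ ∸ 1 else 0

  excess+∣πS∣≡∣S∣ : ∀ S → excess S + ∣ indexSet cls S ∣ ≡ ∣ S ∣
  excess+∣πS∣≡∣S∣ S = begin
    excess S + ∣ I ∣                          ≡⟨ cong (excess S +_) (∣p∣≡∑ I) ⟩
    ∑ e + ∑ (λ j → 𝟙 (lookup I j))            ≡⟨ sym (∑-distrib-+ e (λ j → 𝟙 (lookup I j))) ⟩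
    ∑ (λ j → e j + 𝟙 (lookup I j))            ≡⟨ ∑-cong per-class ⟩
    ∑ (λ j → ∣ S ∩ classOf cls j ∣)            ≡⟨ sym (∣W∣≡∑classes S) ⟩
    ∣ S ∣                                     ∎
    where
    open ≡-Reasoning
    I : Subset k
    I = indexSet cls S
    e : Fin k → ℕ
    e j = if lookup I j then ∣ S ∩ classOf cls j ∣ ∸ 1 else 0
    per-class : ∀ j → e j + 𝟙 (lookup I j) ≡ ∣ S ∩ classOf cls j ∣
    per-class j with lookup I j in Ij
    ... | true = m∸n+n≡m (subst (_≤ ∣ S ∩ classOf cls j ∣) (cong 𝟙 Ij) (𝟙-indexSet≤ S j))
    ... | false = sym (∣∩class∣≡0 S (λ j∈I → true≢false (trans (sym (∈⇒lookup j∈I)) Ij)))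

module TwinClasses {n k} (G : Graph n) (rep : Fin k → Fin n) (cls : Fin n → Fin k)
                   (twin : ∀ v → Twin G v (rep (cls v)))
                   (rep-inj : ∀ i j → Twin G (rep i) (rep j) → i ≡ j) where

  H : Graph k
  H = induced G rep

  cls-rep : ∀ i → cls (rep i) ≡ i
  cls-rep i = rep-inj (cls (rep i)) i (λ w → ⇔-sym (twin (rep i) w))

  adj-class-invariantˡ : ∀ {x x′ y} → cls x ≡ cls x′ → cls x ≢ cls y → adj G x y ≡ true → adj G x′ y ≡ true
  adj-class-invariantˡ {x} {x′} {y} x~x′ x≁y xy =
    proj₁ (Equivalence.from (twin x′ y) (subst (λ c → adj G (rep c) y ≡ true) x~x′ rep-xy , y≢x′))
    where
    rep-xy : adj G (rep (cls x)) y ≡ true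
    rep-xy = proj₁ (Equivalence.to (twin x y)
                     (xy , λ y≡rep → x≁y (sym (trans (cong cls y≡rep) (cls-rep (cls x))))))
    y≢x′ : y ≢ x′
    y≢x′ y≡x′ = x≁y (trans x~x′ (cong cls (sym y≡x′)))

  adj-class-invariant : ∀ {x x′ y y′} → cls x ≡ cls x′ → cls y ≡ cls y′ → cls x ≢ cls y →
                        adj G x y ≡ true → adj G x′ y′ ≡ true
  adj-class-invariant {x′ = x′} {y} {y′} x~x′ y~y′ x≁y xy =
    trans (adj-sym G x′ y′) (adj-class-invariantˡ y~y′ (λ y~x′ → x≁y (trans x~x′ (sym y~x′)))
                              (trans (adj-sym G y x′) (adj-class-invariantˡ x~x′ x≁y xy)))

  adj⇒adjᴴ : ∀ {x y} → cls x ≢ cls y → adj G x y ≡ true → adj H (cls x) (cls y) ≡ true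
  adj⇒adjᴴ x≁y = adj-class-invariant (sym (cls-rep _)) (sym (cls-rep _)) x≁y

  adjᴴ⇒adj : ∀ {x y} → adj H (cls x) (cls y) ≡ true → adj G x y ≡ true
  adjᴴ⇒adj {x} {y} e = adj-class-invariant (cls-rep (cls x)) (cls-rep (cls y)) rep-x≁rep-y e
    where
    rep-x≁rep-y : cls (rep (cls x)) ≢ cls (rep (cls y))
    rep-x≁rep-y c≡c rewrite cls-rep (cls x) | cls-rep (cls y) | c≡c =
      true≢false (trans (sym e) (irrefl H (cls y)))

  project-walk : ∀ {W x y} → Walk (Within (adj G) W) x y →
                 Walk (Within (adj H) (indexSet cls W)) (cls x) (cls y)
  project-walk [] = []
  project-walk {W} (_∷_ {u = a} {v = b} e w) with cls a ≟ cls b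
  ... | yes a~b rewrite a~b = project-walk {W} w
  ... | no a≁b = let (ab , b∈W) = within⁻ {A = adj G} {W} e
                 in within⁺ {A = adj H} (adj⇒adjᴴ a≁b ab) (∈indexSet⁺ cls b∈W) ∷ project-walk {W} w

  project-cover : ∀ {s S W} → ConnectedCover G s S W →
                  ConnectedCover H (cls s) (indexSet cls S) (indexSet cls W)
  project-cover {s} {S} {W} (S⊆W , walks) = I⊆πW , πwalks
    where
    I⊆πW : indexSet cls S ⊆ indexSet cls W
    I⊆πW j∈I = let (x , x∈S , cx≡j) = ∈indexSet⁻ cls S j∈I
               in subst (_∈ indexSet cls W) cx≡j (∈indexSet⁺ cls (S⊆W x∈S))
    πwalks : WalkConnected H (cls s) (indexSet cls W)
    πwalks j j∈πW = let (x , x∈W , cx≡j) = ∈indexSet⁻ cls W j∈πW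
                    in subst (Walk _ (cls s)) cx≡j (project-walk {W} (walks x x∈W))

  lift-walk : ∀ {σ : Fin k → Fin n} → (∀ j → cls (σ j) ≡ j) → ∀ {U W} → (∀ {j} → j ∈ U → σ j ∈ W) →
              ∀ {i j} → Walk (Within (adj H) U) i j → Walk (Within (adj G) W) (σ i) (σ j)
  lift-walk cls-σ σ∈ [] = []
  lift-walk {σ} cls-σ σ∈ (_∷_ {u = a} {v = b} e w) =
    let (ab , b∈U) = within⁻ {A = adj H} e
        σab : adj G (σ a) (σ b) ≡ true
        σab = adjᴴ⇒adj (subst₂ (λ p q → adj H p q ≡ true) (sym (cls-σ a)) (sym (cls-σ b)) ab)
    in within⁺ {A = adj G} σab (σ∈ b∈U) ∷ lift-walk cls-σ σ∈ w

  module SingleClass {S : Subset n} {i : Fin k} (I≡⁅i⁆ : indexSet cls S ≡ ⁅ i ⁆) where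

    in-class : ∀ {s} → s ∈ S → cls s ≡ i
    in-class {s} s∈S = x∈⁅y⁆⇒x≡y i (subst (cls s ∈_) I≡⁅i⁆ (∈indexSet⁺ cls s∈S))

    steinerDist-complete : IsComplete G (classOf cls i) → ∀ {s} → s ∈ S → IsSteinerDist G S (∣ S ∣ ∸ 1)
    steinerDist-complete complete {s} s∈S =
      minCoverSize⇒steinerDist s∈S ((S , ((λ x∈S → x∈S) , walks) , ≤-refl) ,
                                    λ U cover → p⊆q⇒∣p∣≤∣q∣ (proj₁ cover))
      where
      walks : WalkConnected G s S
      walks v v∈S with v ≟ s
      ... | yes refl = []
      ... | no v≢s = within⁺ {A = adj G} sv v∈S ∷ []
        where
        sv : adj G s v ≡ true
        sv = complete s v (∈classOf⁺ cls (in-class s∈S)) (∈classOf⁺ cls (in-class v∈S)) (λ s≡v → v≢s (sym s≡v))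

    -- S is independent, so a tree through S needs a further vertex; a neighbour z of s serves
    -- all of S, since adjacency to z depends only on the twin class.
    steinerDist-edgeless : Connected G → IsEdgeless G (classOf cls i) → ∀ {s s′} → s ∈ S → s′ ∈ S → s ≢ s′ →
                           IsSteinerDist G S ∣ S ∣
    steinerDist-edgeless connectedG edgeless {s} {s′} s∈S s′∈S s≢s′ =
      minCoverSize⇒steinerDist s∈S ((U , (S⊆U , walks) , ≤-reflexive (∣p∪⁅x⁆∣≡1+∣p∣ S z∉S)) , minimal)
      where
      neighbour-of-s : Σ (Fin n) λ z → adj G s z ≡ true
      neighbour-of-s with connectedG s s′
      ... | [] = ⊥-elim (s≢s′ refl)
      ... | sz ∷ _ = _ , sz
      z : Fin n
      z = proj₁ neighbour-of-s
      sz : adj G s z ≡ true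
      sz = proj₂ neighbour-of-s
      off-class : ∀ {y} → adj G s y ≡ true → cls y ≢ i
      off-class {y} sy y~i =
        true≢false (trans (sym sy) (edgeless s y (∈classOf⁺ cls (in-class s∈S)) (∈classOf⁺ cls y~i)))
      outside-S : ∀ {y} → adj G s y ≡ true → y ∉ S
      outside-S sy y∈S = off-class sy (in-class y∈S)
      z∉S : z ∉ S
      z∉S = outside-S sz
      zv : ∀ {v} → v ∈ S → adj G z v ≡ true
      zv v∈S = adj-class-invariant refl (trans (in-class s∈S) (sym (in-class v∈S)))
                 (λ z~s → off-class sz (trans z~s (in-class s∈S))) (trans (adj-sym G z s) sz)
      U : Subset n
      U = S ∪ ⁅ z ⁆
      S⊆U : S ⊆ U
      S⊆U v∈S = x∈p∪q⁺ (inj₁ v∈S)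
      z∈U : z ∈ U
      z∈U = x∈p∪q⁺ (inj₂ (x∈⁅x⁆ z))
      walks : WalkConnected G s U
      walks v v∈U with x∈p∪q⁻ S ⁅ z ⁆ v∈U
      ... | inj₁ v∈S = within⁺ {A = adj G} sz z∈U ∷ within⁺ {A = adj G} (zv v∈S) v∈U ∷ []
      ... | inj₂ v∈⁅z⁆ rewrite x∈⁅y⁆⇒x≡y z v∈⁅z⁆ = within⁺ {A = adj G} sz z∈U ∷ []
      minimal : ∀ U′ → ConnectedCover G s S U′ → suc ∣ S ∣ ≤ ∣ U′ ∣
      minimal U′ (S⊆U′ , walks′) = let (w , w∈U′ , sw) = first-step (walks′ s′ (S⊆U′ s′∈S)) s≢s′
                                   in p⊂q⇒∣p∣<∣q∣ (S⊆U′ , w , w∈U′ , outside-S sw)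

  module Reduction (S : Subset n) {i₀ i₁ : Fin k} (i₀∈I : i₀ ∈ indexSet cls S) (i₁∈I : i₁ ∈ indexSet cls S)
                   (i₀≢i₁ : i₀ ≢ i₁) where

    I : Subset k
    I = indexSet cls S

    σ : Fin k → Fin n
    σ j with j ∈? I
    ... | yes j∈I = proj₁ (∈indexSet⁻ cls S j∈I)
    ... | no _ = rep j

    cls-σ : ∀ j → cls (σ j) ≡ j
    cls-σ j with j ∈? I
    ... | yes j∈I = proj₂ (proj₂ (∈indexSet⁻ cls S j∈I))
    ... | no _ = cls-rep j

    σ∈S : ∀ {j} → j ∈ I → σ j ∈ S
    σ∈S {j} j∈I with j ∈? I
    ... | yes j∈I′ = proj₁ (proj₂ (∈indexSet⁻ cls S j∈I′))
    ... | no j∉I = ⊥-elim (j∉I j∈I)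

    σ∉I : ∀ {j} → j ∉ I → σ j ≡ rep j
    σ∉I {j} j∉I with j ∈? I
    ... | yes j∈I = ⊥-elim (j∉I j∈I)
    ... | no _ = refl

    NewRep : Subset k → Fin n → Set
    NewRep U x = x ≡ rep (cls x) × cls x ∈ U × cls x ∉ I

    newRep? : ∀ U x → Dec (NewRep U x)
    newRep? U x = (x ≟ rep (cls x)) ×-dec (cls x ∈? U) ×-dec ¬? (cls x ∈? I)

    lift : Subset k → Subset n
    lift U = S ∪ subsetOf (newRep? U)

    lift⁻ : ∀ {U x} → x ∈ lift U → x ∈ S ⊎ NewRep U x
    lift⁻ {U} x∈ with x∈p∪q⁻ S _ x∈
    ... | inj₁ x∈S = inj₁ x∈S
    ... | inj₂ x∈R = inj₂ (∈-subsetOf⁻ (newRep? U) x∈R)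

    σ∈lift : ∀ {U j} → j ∈ U → σ j ∈ lift U
    σ∈lift {U} {j} j∈U = by-cases (j ∈? I)
      where
      by-cases : Dec (j ∈ I) → σ j ∈ lift U
      by-cases (yes j∈I) = x∈p∪q⁺ (inj₁ (σ∈S j∈I))
      by-cases (no j∉I) rewrite σ∉I j∉I = x∈p∪q⁺ (inj₂ (∈-subsetOf⁺ (newRep? U) new))
        where
        new : NewRep U (rep j)
        new = cong rep (sym (cls-rep j)) , subst (_∈ U) (sym (cls-rep j)) j∈U , subst (_∉ I) (sym (cls-rep j)) j∉I

    lift∩class⊆rep : ∀ {U j x} → j ∉ I → x ∈ lift U ∩ classOf cls j → x ≡ rep j × j ∈ U
    lift∩class⊆rep {U} {j} j∉I x∈ with x∈p∩q⁻ (lift U) (classOf cls j) x∈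
    ... | x∈L , x∈C with lift⁻ x∈L | ∈classOf⁻ cls x∈C
    ...   | inj₁ x∈S | refl = ⊥-elim (j∉I (∈indexSet⁺ cls x∈S))
    ...   | inj₂ (x≡rep , cx∈U , _) | refl = x≡rep , cx∈U

    -- Every vertex of the lift is reached through a neighbour class, whose lifted walk ends next to it.
    lift-cover : ∀ {U} → ConnectedCover H i₀ I U → ConnectedCover G (σ i₀) S (lift U)
    lift-cover {U} (I⊆U , walks) = (λ x∈S → x∈p∪q⁺ (inj₁ x∈S)) , lift-walks
      where
      cls∈U : ∀ {x} → x ∈ lift U → cls x ∈ U
      cls∈U x∈ with lift⁻ x∈
      ... | inj₁ x∈S = I⊆U (∈indexSet⁺ cls x∈S)
      ... | inj₂ (_ , cx∈U , _) = cx∈U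
      lift-walks : WalkConnected G (σ i₀) (lift U)
      lift-walks v v∈ =
        let (y , y∈U , yv) = neighbour {X = H} walks (I⊆U i₀∈I) (I⊆U i₁∈I) (λ i₁≡i₀ → i₀≢i₁ (sym i₁≡i₀))
                                       (cls∈U v∈)
            σy-v = adjᴴ⇒adj (subst (λ c → adj H c (cls v) ≡ true) (sym (cls-σ y)) yv)
        in lift-walk cls-σ σ∈lift (walks y y∈U) ++ʷ (within⁺ {A = adj G} σy-v v∈ ∷ [])

    lift-size : ∀ {U} → I ⊆ U → ∣ lift U ∣ + ∣ I ∣ ≤ ∣ S ∣ + ∣ U ∣
    lift-size {U} I⊆U = classwise-≤ cls (lift U) S I U per-class
      where
      per-class : ∀ j → ∣ lift U ∩ classOf cls j ∣ + 𝟙 (lookup I j) ≤ ∣ S ∩ classOf cls j ∣ + 𝟙 (lookup U j)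
      per-class j with j ∈? I
      ... | yes j∈I = +-mono-≤ (p⊆q⇒∣p∣≤∣q∣ L∩C⊆S∩C) (≤-reflexive (trans (𝟙-∈ j∈I) (sym (𝟙-∈ (I⊆U j∈I)))))
        where
        L∩C⊆S∩C : lift U ∩ classOf cls j ⊆ S ∩ classOf cls j
        L∩C⊆S∩C {x} x∈ with x∈p∩q⁻ (lift U) (classOf cls j) x∈
        ... | x∈L , x∈C with lift⁻ x∈L
        ...   | inj₁ x∈S = x∈p∩q⁺ (x∈S , x∈C)
        ...   | inj₂ (_ , _ , cx∉I) = ⊥-elim (cx∉I (subst (_∈ I) (sym (∈classOf⁻ cls x∈C)) j∈I))
      ... | no j∉I = subst₂ _≤_ (trans (sym (+-identityʳ _))
                                       (cong (∣ lift U ∩ classOf cls j ∣ +_) (sym (𝟙-∉ j∉I))))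
                                (cong (_+ 𝟙 (lookup U j)) (sym (∣∩class∣≡0 cls S j∉I)))
                                at-most-rep
        where
        at-most-rep : ∣ lift U ∩ classOf cls j ∣ ≤ 𝟙 (lookup U j)
        at-most-rep with j ∈? U
        ... | yes j∈U = subst (∣ lift U ∩ classOf cls j ∣ ≤_) (trans (∣⁅x⁆∣≡1 (rep j)) (sym (𝟙-∈ j∈U)))
                              (p⊆q⇒∣p∣≤∣q∣ ⊆⁅rep⁆)
          where
          ⊆⁅rep⁆ : lift U ∩ classOf cls j ⊆ ⁅ rep j ⁆
          ⊆⁅rep⁆ x∈ = subst (_∈ ⁅ rep j ⁆) (sym (proj₁ (lift∩class⊆rep j∉I x∈))) (x∈⁅x⁆ (rep j))
        ... | no j∉U =
          ≤-reflexive (trans (∣p∣≡0 (λ x∈ → j∉U (proj₂ (lift∩class⊆rep j∉I x∈)))) (sym (𝟙-∉ j∉U)))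

    minCoverSize-reduction : ∀ {e c} → e + ∣ I ∣ ≡ ∣ S ∣ → IsMinCoverSize H i₀ I c →
                             IsMinCoverSize G (σ i₀) S (e + c)
    minCoverSize-reduction {e} {c} e+∣I∣≡∣S∣ ((U , coverU , ∣U∣≤c) , minimal) =
      (lift U , lift-cover coverU , upper) , lower
      where
      open ≤-Reasoning
      upper : ∣ lift U ∣ ≤ e + c
      upper = +-cancelʳ-≤ ∣ I ∣ _ _ (begin
        ∣ lift U ∣ + ∣ I ∣   ≤⟨ lift-size (proj₁ coverU) ⟩
        ∣ S ∣ + ∣ U ∣        ≤⟨ +-monoʳ-≤ ∣ S ∣ ∣U∣≤c ⟩
        ∣ S ∣ + c            ≡⟨ cong (_+ c) (sym e+∣I∣≡∣S∣) ⟩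
        e + ∣ I ∣ + c        ≡⟨ xy∙z≈xz∙y e ∣ I ∣ c ⟩
        e + c + ∣ I ∣        ∎)
      lower : ∀ W → ConnectedCover G (σ i₀) S W → e + c ≤ ∣ W ∣
      lower W coverW = +-cancelʳ-≤ ∣ I ∣ _ _ (begin
        e + c + ∣ I ∣                ≡⟨ xy∙z≈xz∙y e c ∣ I ∣ ⟩
        e + ∣ I ∣ + c                ≡⟨ cong (_+ c) e+∣I∣≡∣S∣ ⟩
        ∣ S ∣ + c                    ≤⟨ +-monoʳ-≤ ∣ S ∣ (minimal (indexSet cls W) πcover) ⟩
        ∣ S ∣ + ∣ indexSet cls W ∣    ≤⟨ ∣S∣+∣πW∣≤∣W∣+∣πS∣ cls (proj₁ coverW) ⟩
        ∣ W ∣ + ∣ I ∣                ∎)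
        where
        πcover : ConnectedCover H i₀ I (indexSet cls W)
        πcover = subst (λ r → ConnectedCover H r I (indexSet cls W)) (cls-σ i₀) (project-cover coverW)

  steinerDist-reduced : Connected G → ∀ S → 1 < ∣ indexSet cls S ∣ →
                        Σ ℕ λ d → IsSteinerDist H (indexSet cls S) d × IsSteinerDist G S (d + excess cls S)
  steinerDist-reduced connectedG S 1<∣I∣ with two-elements (indexSet cls S) 1<∣I∣
  ... | i₀ , i₁ , i₀∈I , i₁∈I , i₀≢i₁ =
    c ∸ 1 , minCoverSize⇒steinerDist i₀∈I minᴴ ,
    subst (IsSteinerDist G S) (trans (+-∸-assoc _ 1≤c) (+-comm _ (c ∸ 1))) distᴳ
    where
    open Reduction S i₀∈I i₁∈I i₀≢i₁
    coverᴴ : ConnectedCover H i₀ I (indexSet cls ⊤)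
    coverᴴ = subst (λ r → ConnectedCover H r I (indexSet cls ⊤)) (cls-σ i₀)
                   (project-cover (⊤-cover {X = G} {σ i₀} {S} connectedG))
    minimum : Σ ℕ (IsMinCoverSize H i₀ I)
    minimum = minCoverSize-exists {X = H} i₀∈I coverᴴ
    c : ℕ
    c = proj₁ minimum
    minᴴ : IsMinCoverSize H i₀ I c
    minᴴ = proj₂ minimum
    1≤c : 1 ≤ c
    1≤c = minCoverSize-positive {X = H} i₀∈I minᴴ
    distᴳ : IsSteinerDist G S ((excess cls S + c) ∸ 1)
    distᴳ = minCoverSize⇒steinerDist (σ∈S i₀∈I) (minCoverSize-reduction (excess+∣πS∣≡∣S∣ cls S) minᴴ)

lemma2p8 : ∀ {n k} (G : Graph n) → Connected G →
    (rep : Fin k → Fin n) (cls : Fin n → Fin k) →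
    (∀ v → Twin G v (rep (cls v))) →
    (∀ i j → Twin G (rep i) (rep j) → i ≡ j) →
    (m : ℕ) → 2 ≤ m → (S : Subset n) → ∣ S ∣ ≡ m →
    let I = indexSet cls S
        H = induced G rep
        t = λ i → ∣ S ∩ classOf cls i ∣
    in ((i : Fin k) → I ≡ ⁅ i ⁆ → IsComplete G (classOf cls i) →
          IsSteinerDist G S (m ∸ 1))
     × ((i : Fin k) → I ≡ ⁅ i ⁆ → IsEdgeless G (classOf cls i) →
          IsSteinerDist G S m)
     × (1 < ∣ I ∣ →
          Σ ℕ λ d → IsSteinerDist H I d ×
            IsSteinerDist G S (d + ∑ λ i → if lookup I i then t i ∸ 1 else 0))
lemma2p8 G connectedG rep cls twin rep-inj m 2≤m S refl with two-elements S 2≤m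
... | s , s′ , s∈S , s′∈S , s≢s′ =
  (λ _ I≡⁅i⁆ complete → SingleClass.steinerDist-complete I≡⁅i⁆ complete s∈S) ,
  (λ _ I≡⁅i⁆ edgeless → SingleClass.steinerDist-edgeless I≡⁅i⁆ connectedG edgeless s∈S s′∈S s≢s′) ,
  steinerDist-reduced connectedG S
  where
  open TwinClasses G rep cls twin rep-inj
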